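{- Let $G$ be a graph and let $\mathcal{C}$ be a family of cycles in $G$ such that each cycle in $\mathcal{C}$ has length at most $\ell$ and every vertex of every cycle in $\mathcal{C}$ has degree (in $G$) at most $d$. If $d\ne 2$, then the expected number of faces of a uniformly random orientable 2-cell embedding of $G$ is at least $\dfrac{2|\mathcal{C}|}{(d-1)^\ell}$.
   Context: Orientable 2-cell embeddings are identified with rotation systems: for each vertex a cyclic permutation of the darts (half-edges) at that vertex. A uniformly random embedding chooses these independently and uniformly. The faces are the orbits of the face permutation $\sigma\cdot\prod_v\pi_v$, where $\sigma$ is the involution exchanging the two darts of each edge. -}

module Defs where

open import Data.Nat using (ℕ; zero; suc; _+_; _≤_)
open import Data.Nat.DivMod using (_%_)
open import Data.Fin using (Fin; toℕ) renaming (_≤_ to _≤ᶠ_)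
open import Data.Fin.Properties using (_≟_; all?; any?) renaming (_≤?_ to _≤ᶠ?_)
open import Data.List using (List; []; _∷_; map; concatMap; filter; length; allFin)
open import Data.Nat.ListAction using (sum)
open import Data.List.Relation.Unary.All using (All)
open import Data.List.Relation.Unary.AllPairs using (AllPairs)
open import Data.Vec using (Vec; []; _∷_; lookup)
open import Data.Product using (Σ; ∃; _×_; _,_)
open import Data.Sum using (_⊎_)
open import Relation.Nullary using (¬_; Dec)
open import Relation.Nullary.Decidable using (_×-dec_; _→-dec_)
open import Relation.Binary.PropositionalEquality using (_≡_; _≢_)
open import Function.Bundles using (_⇔_)

-- A (multi)graph given as a combinatorial set of darts (half-edges):
-- n vertices, D darts, each dart has a tail vertex, and the fixed-point
-- free involution σ exchanges the two darts of each edge.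
-- Loops and multiple edges are allowed.

record Graph : Set where
  field
    n       : ℕ
    D       : ℕ
    tail    : Fin D → Fin n
    σ       : Fin D → Fin D
    σ-invol : ∀ x → σ (σ x) ≡ x
    σ-nofix : ∀ x → σ x ≢ x

open Graph public

head : (G : Graph) → Fin (D G) → Fin (n G)
head G x = tail G (σ G x)

-- degree of a vertex = number of darts at it (a loop counts twice)
deg : (G : Graph) → Fin (n G) → ℕ
deg G v = length (filter (λ x → tail G x ≟ v) (allFin (D G)))

iter : {A : Set} → (A → A) → ℕ → A → A
iter f zero    a = a
iter f (suc k) a = f (iter f k a)

-- Rotation systems: a permutation π of the darts which preserves the
-- tail vertex and acts as a single cycle on the darts at each vertex
-- (i.e. for each vertex v a cyclic permutation π_v of the darts at v).
-- Orbits have size at most D, so "y is in the π-orbit of x" is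
-- witnessed by some exponent k < D.

IsRotation : (G : Graph) → (Fin (D G) → Fin (D G)) → Set
IsRotation G π =
  (∀ x → tail G (π x) ≡ tail G x) ×
  (∀ x y → π x ≡ π y → x ≡ y) ×
  (∀ x y → tail G x ≡ tail G y → ∃ λ (k : Fin (D G)) → iter π (toℕ k) x ≡ y)

isRotation? : (G : Graph) → (π : Fin (D G) → Fin (D G)) → Dec (IsRotation G π)
isRotation? G π =
  all? (λ x → tail G (π x) ≟ tail G x) ×-dec
  (all? λ x → all? λ y → (π x ≟ π y) →-dec (x ≟ y)) ×-dec
  (all? λ x → all? λ y → (tail G x ≟ tail G y) →-dec
      any? (λ k → iter π (toℕ k) x ≟ y))

allVecs : (m k : ℕ) → List (Vec (Fin m) k)
allVecs m zero    = [] ∷ []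
allVecs m (suc k) = concatMap (λ a → map (a ∷_) (allVecs m k)) (allFin m)

allFuns : (m : ℕ) → List (Fin m → Fin m)
allFuns m = map lookup (allVecs m m)

rotations : (G : Graph) → List (Fin (D G) → Fin (D G))
rotations G = filter (isRotation? G) (allFuns (D G))

-- Faces: orbits of the face permutation φ = σ ∘ π.  The number of
-- orbits is counted as the number of darts that are the least element
-- of their orbit (every orbit element is φ^k x for some k < D).

faceperm : (G : Graph) → (Fin (D G) → Fin (D G)) → Fin (D G) → Fin (D G)
faceperm G π x = σ G (π x)

IsOrbitMin : (G : Graph) → (Fin (D G) → Fin (D G)) → Fin (D G) → Set
IsOrbitMin G π x = ∀ (k : Fin (D G)) → x ≤ᶠ iter (faceperm G π) (toℕ k) x

numFaces : (G : Graph) → (Fin (D G) → Fin (D G)) → ℕ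
numFaces G π =
  length (filter {P = IsOrbitMin G π}
                 (λ x → all? (λ k → x ≤ᶠ? iter (faceperm G π) (toℕ k) x))
                 (allFin (D G)))

-- total number of faces summed over all rotation systems;
-- expected number of faces = totalFaces G / numRotations G
totalFaces : (G : Graph) → ℕ
totalFaces G = sum (map (numFaces G) (rotations G))

numRotations : (G : Graph) → ℕ
numRotations G = length (rotations G)

-- A cycle of length k ≥ 1 is a cyclic sequence of darts
-- c 0, …, c (k-1) with head (c i) = tail (c (i+1 mod k)), pairwise
-- distinct vertices tail (c i), and pairwise distinct edges (the only
-- extra content is for k = 2: the two edges of a digon are different).
-- Length-1 cycles are loops, length-2 cycles are digons.

record Cycle (G : Graph) : Set where
  field
    k        : ℕ          -- the cycle has length suc k ≥ 1
    dart     : Fin (suc k) → Fin (D G)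
    closed   : (i j : Fin (suc k)) → toℕ j ≡ suc (toℕ i) % suc k →
               head G (dart i) ≡ tail G (dart j)
    vert-inj : ∀ i j → tail G (dart i) ≡ tail G (dart j) → i ≡ j
    edge-dst : ∀ i j → dart j ≢ σ G (dart i)

open Cycle public

cycLength : {G : Graph} → Cycle G → ℕ
cycLength c = suc (k c)

InCycle : {G : Graph} → Cycle G → Fin (D G) → Set
InCycle {G} c x = ∃ λ i → (dart c i ≡ x) ⊎ (σ G (dart c i) ≡ x)

-- two cycles are the same subgraph iff they have the same edge set
SameCycle : {G : Graph} → Cycle G → Cycle G → Set
SameCycle c c′ = ∀ x → InCycle c x ⇔ InCycle c′ x

DistinctCycles : {G : Graph} → Cycle G → Cycle G → Set
DistinctCycles c c′ = ¬ SameCycle c c′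

-- Each cycle of 𝒞, traversed in either direction, becomes a face as soon as the
-- rotation at each of its vertices sends the incoming dart (reversed) to the
-- outgoing one.  These are prescriptions at distinct vertices, and a rotation
-- system can be made to obey them by conjugating with one transposition per
-- vertex; remembering the overwritten values (at most d − 1 choices each)
-- makes this injective, so at least numRotations / (d − 1)^ℓ rotation systems
-- obey the prescriptions of each of the 2|𝒞| oriented cycles.  A rotation
-- system obeying the prescriptions of several oriented cycles has a different
-- face for each of them, and double counting gives the bound.

module Submission where

open import Defs
open import Data.Fin as Fin using (Fin; toℕ; fromℕ<)
open import Data.Fin.Properties as Finₚ using (pigeonhole)
open import Data.Nat using (ℕ; zero; suc; _+_; _*_; _∸_; _^_; _≤_; _<_; z≤n; s≤s)
open import Data.Nat.Properties as ℕₚ using (≤-refl; ≤-trans; ≤-reflexive; ≮⇒≥)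
open import Data.Nat.ListAction using (sum)
open import Data.Nat.DivMod using (_%_; m%n<n; m<n⇒m%n≡m; n%n≡0)
open import Data.List as List
  using (List; []; _∷_; length; map; filter; concatMap; allFin; cartesianProductWith; cartesianProduct)
open import Data.List.Properties as Listₚ using (length-++; length-map)
open import Data.List.Relation.Unary.All as All using (All; []; _∷_)
import Data.List.Relation.Unary.All.Properties as Allₚ
open import Data.List.Relation.Unary.Any as Any using (Any; here; there)
import Data.List.Relation.Unary.Any.Properties as Anyₚ
open import Data.List.Relation.Unary.AllPairs as AllPairs using (AllPairs; []; _∷_)
import Data.List.Relation.Unary.AllPairs.Properties as AllPairsₚ
open import Data.List.Relation.Binary.Pointwise using (Pointwise; []; _∷_)
open import Data.List.Membership.Propositional using (_∈_)
open import Data.List.Membership.Propositional.Properties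
  using (∈-cartesianProductWith⁺; ∈-lookup; ∈-allFin; ∈-map⁺; ∈-filter⁺; ∈-filter⁻)
open import Data.List.Relation.Unary.Unique.Propositional using (Unique)
open import Data.List.Relation.Unary.Unique.Propositional.Properties using (allFin⁺)
import Data.List.Extrema as Extrema
open import Data.Vec as Vec using (Vec; tabulate)
open import Data.Vec.Properties using (∷-injectiveˡ; ∷-injectiveʳ; tabulate-cong; tabulate∘lookup; lookup∘tabulate)
open import Data.Product using (∃; _×_; _,_; proj₁; proj₂; uncurry)
open import Function.Bundles using (mk⇔)
open import Function using (_∘_)
open import Relation.Nullary using (¬_; Dec; yes; no; ¬?)
open import Data.Empty using (⊥-elim)
open import Data.Sum using (_⊎_; inj₁; inj₂; [_,_]′)
import Data.Fin.Permutation.Components as PC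
open import Data.Fin.Permutation using (Permutation′; _⟨$⟩ʳ_; _⟨$⟩ˡ_; inverseˡ; inverseʳ; transpose)
open import Relation.Unary using (Decidable)
open import Relation.Binary.PropositionalEquality
open import Algebra.Properties.CommutativeSemigroup ℕₚ.+-commutativeSemigroup using (interchange)

private
  variable
    A B C : Set

AllPairs-lookup : ∀ {R : A → A → Set} {xs} → AllPairs R xs →
  ∀ {i j : Fin (length xs)} → i Fin.< j → R (List.lookup xs i) (List.lookup xs j)
AllPairs-lookup {xs = _ ∷ _} (Rx ∷ _)   {Fin.zero}  {Fin.suc j} _         = All.lookup Rx (∈-lookup j)
AllPairs-lookup {xs = _ ∷ _} (_ ∷ Rxs) {Fin.suc i} {Fin.suc j} (s≤s i<j) = AllPairs-lookup Rxs i<j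

length≤-distinct : ∀ {m} (zs : List (Fin m)) → AllPairs _≢_ zs → length zs ≤ m
length≤-distinct zs distinct = ≮⇒≥ λ m<length →
  let i , j , i<j , zsᵢ≡zsⱼ = pigeonhole m<length (List.lookup zs) in
  AllPairs-lookup distinct i<j zsᵢ≡zsⱼ

-- The positions in ys of the witnesses for xs are pairwise distinct.
length≤-byInjectiveRelation : (_#_ : A → A → Set) (R : A → B → Set) {xs : List A} {ys : List B} →
  AllPairs _#_ xs → All (λ x → Any (R x) ys) xs →
  (∀ {x x′ y} → R x y → R x′ y → ¬ (x # x′)) → length xs ≤ length ys
length≤-byInjectiveRelation {A = A} _#_ R {xs} {ys} apart total injective = begin
    length xs             ≡⟨ length-positions total ⟨
    length (positions total) ≤⟨ length≤-distinct (positions total) (positions-distinct apart total) ⟩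
    length ys             ∎
  where
  open ℕₚ.≤-Reasoning
  Witnessed : List A → Set
  Witnessed = All (λ x → Any (R x) ys)

  positions : ∀ {zs} → Witnessed zs → List (Fin (length ys))
  positions = All.reduce Any.index

  length-positions : ∀ {zs} (ws : Witnessed zs) → length (positions ws) ≡ length zs
  length-positions []       = refl
  length-positions (_ ∷ ws) = cong suc (length-positions ws)

  index-injective : ∀ {x x′} (w : Any (R x) ys) (w′ : Any (R x′) ys) → x # x′ → Any.index w ≢ Any.index w′
  index-injective w w′ x#x′ eq =
    injective (Anyₚ.lookup-index w) (subst (R _ ∘ List.lookup ys) (sym eq) (Anyₚ.lookup-index w′)) x#x′

  positions-distinct : ∀ {zs} → AllPairs _#_ zs → (ws : Witnessed zs) → AllPairs _≢_ (positions ws)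
  positions-distinct []             []       = []
  positions-distinct (x#zs ∷ apart′) (w ∷ ws) = away x#zs ws ∷ positions-distinct apart′ ws
    where
    away : ∀ {zs} → All (_ #_) zs → (ws : Witnessed zs) → All (Any.index w ≢_) (positions ws)
    away []          []        = []
    away (x#z ∷ x#zs) (w′ ∷ ws) = index-injective w w′ x#z ∷ away x#zs ws

length-cartesianProductWith : (f : A → B → C) (xs : List A) (ys : List B) →
  length (cartesianProductWith f xs ys) ≡ length xs * length ys
length-cartesianProductWith f []       ys = refl
length-cartesianProductWith f (x ∷ xs) ys = begin
  length (map (f x) ys List.++ cartesianProductWith f xs ys)
    ≡⟨ length-++ (map (f x) ys) ⟩
  length (map (f x) ys) + length (cartesianProductWith f xs ys)
    ≡⟨ cong₂ _+_ (length-map (f x) ys) (length-cartesianProductWith f xs ys) ⟩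
  length ys + length xs * length ys
    ∎
  where open ≡-Reasoning

Any-cartesianProduct⁺ : ∀ {P : A × B → Set} {xs ys y} →
  Any (λ x → P (x , y)) xs → y ∈ ys → Any P (cartesianProduct xs ys)
Any-cartesianProduct⁺ {xs = x ∷ _} (here p) y∈ys = Anyₚ.++⁺ˡ (Anyₚ.map⁺ (Any.map (λ { refl → p }) y∈ys))
Any-cartesianProduct⁺ {xs = x ∷ _} {ys} (there p) y∈ys = Anyₚ.++⁺ʳ (map (x ,_) ys) (Any-cartesianProduct⁺ p y∈ys)

choices : List (List A) → List (List A)
choices []         = [] ∷ []
choices (xs ∷ xss) = cartesianProductWith _∷_ xs (choices xss)

∈-choices : ∀ {ys : List A} {xss} → Pointwise _∈_ ys xss → ys ∈ choices xss
∈-choices []             = here refl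
∈-choices (y∈xs ∷ ys∈xss) = ∈-cartesianProductWith⁺ _∷_ y∈xs (∈-choices ys∈xss)

length-choices-≤ : ∀ {m} (xss : List (List A)) → All (λ xs → length xs ≤ m) xss →
  length (choices xss) ≤ m ^ length xss
length-choices-≤           []         []       = ≤-refl
length-choices-≤ {m = m} (xs ∷ xss) (h ∷ hs) = begin
  length (choices (xs ∷ xss))     ≡⟨ length-cartesianProductWith _∷_ xs (choices xss) ⟩
  length xs * length (choices xss) ≤⟨ ℕₚ.*-mono-≤ h (length-choices-≤ xss hs) ⟩
  m * m ^ length xss              ∎
  where open ℕₚ.≤-Reasoning

indicator : ∀ {P : Set} → Dec P → ℕ
indicator (yes _) = 1
indicator (no  _) = 0

length-filter-∷ : ∀ {P : A → Set} (P? : Decidable P) x xs →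
  length (filter P? (x ∷ xs)) ≡ indicator (P? x) + length (filter P? xs)
length-filter-∷ P? x xs with P? x
... | yes _ = refl
... | no  _ = refl

sum-map-indicator : ∀ {P : A → Set} (P? : Decidable P) xs →
  sum (map (indicator ∘ P?) xs) ≡ length (filter P? xs)
sum-map-indicator P? []       = refl
sum-map-indicator P? (x ∷ xs) =
  trans (cong (indicator (P? x) +_) (sum-map-indicator P? xs)) (sym (length-filter-∷ P? x xs))

sum-map-zero : (xs : List A) → sum (map (λ _ → 0) xs) ≡ 0
sum-map-zero []       = refl
sum-map-zero (_ ∷ xs) = sum-map-zero xs

sum-map-+ : (f g : A → ℕ) (xs : List A) → sum (map (λ x → f x + g x) xs) ≡ sum (map f xs) + sum (map g xs)
sum-map-+ f g []       = refl
sum-map-+ f g (x ∷ xs) =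
  trans (cong (f x + g x +_) (sum-map-+ f g xs)) (interchange (f x) (g x) (sum (map f xs)) (sum (map g xs)))

sum-map-mono : (f g : A → ℕ) (xs : List A) → (∀ x → f x ≤ g x) → sum (map f xs) ≤ sum (map g xs)
sum-map-mono f g []       f≤g = z≤n
sum-map-mono f g (x ∷ xs) f≤g = ℕₚ.+-mono-≤ (f≤g x) (sum-map-mono f g xs f≤g)

length*≤sum-map* : ∀ {c K} (f : A → ℕ) (xs : List A) → All (λ x → c ≤ f x * K) xs →
  length xs * c ≤ sum (map f xs) * K
length*≤sum-map*             f []       []       = z≤n
length*≤sum-map* {c = c} {K} f (x ∷ xs) (h ∷ hs) = begin
  c + length xs * c           ≤⟨ ℕₚ.+-mono-≤ h (length*≤sum-map* f xs hs) ⟩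
  f x * K + sum (map f xs) * K ≡⟨ ℕₚ.*-distribʳ-+ K (f x) (sum (map f xs)) ⟨
  sum (map f (x ∷ xs)) * K    ∎
  where open ℕₚ.≤-Reasoning

^-monoʳ-≤-suc : ∀ m {a b} → suc a ≤ b → m ^ suc a ≤ m ^ b
^-monoʳ-≤-suc zero    (s≤s _) = z≤n
^-monoʳ-≤-suc (suc m) a<b     = ℕₚ.^-monoʳ-≤ (suc m) a<b

double-counting : ∀ {E X : Set} {Q : E → X → Set} (Q? : ∀ e x → Dec (Q e x)) (es : List E) (xs : List X) →
  sum (map (λ e → length (filter (Q? e) xs)) es) ≡ sum (map (λ x → length (filter (λ e → Q? e x) es)) xs)
double-counting Q? es []       = sum-map-zero es
double-counting Q? es (x ∷ xs) = begin
    sum (map (λ e → length (filter (Q? e) (x ∷ xs))) es)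
  ≡⟨ cong sum (Listₚ.map-cong (λ e → length-filter-∷ (Q? e) x xs) es) ⟩
    sum (map (λ e → indicator (Q? e x) + length (filter (Q? e) xs)) es)
  ≡⟨ sum-map-+ (λ e → indicator (Q? e x)) (λ e → length (filter (Q? e) xs)) es ⟩
    sum (map (λ e → indicator (Q? e x)) es) + sum (map (λ e → length (filter (Q? e) xs)) es)
  ≡⟨ cong₂ _+_ (sum-map-indicator (λ e → Q? e x) es) (double-counting Q? es xs) ⟩
    length (filter (λ e → Q? e x) es) + sum (map (λ x → length (filter (λ e → Q? e x) es)) xs)
  ∎
  where open ≡-Reasoning

allVecs-complete : ∀ m k (v : Vec (Fin m) k) → v ∈ allVecs m k
allVecs-complete m zero    Vec.[]       = here refl
allVecs-complete m (suc k) (a Vec.∷ v) =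
  Anyₚ.concatMap⁺ (λ b → List.map (b Vec.∷_) (allVecs m k))
    (Any.map (λ { refl → ∈-map⁺ (a Vec.∷_) (allVecs-complete m k v) }) (∈-allFin a))

allVecs-unique : ∀ m k → Unique (allVecs m k)
allVecs-unique m zero    = [] ∷ []
allVecs-unique m (suc k) = AllPairsₚ.concat⁺
  (Allₚ.map⁺ (All.tabulate λ _ →
    AllPairsₚ.map⁺ (AllPairs.map (λ u≢v → u≢v ∘ ∷-injectiveʳ) (allVecs-unique m k))))
  (AllPairsₚ.map⁺ (AllPairs.map (λ a≢b → Allₚ.map⁺ (All.tabulate λ _ →
    Allₚ.map⁺ (All.tabulate λ _ → a≢b ∘ ∷-injectiveˡ))) (allFin⁺ m)))

lookup-≗⇒≡ : ∀ {k} {u v : Vec A k} → Vec.lookup u ≗ Vec.lookup v → u ≡ v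
lookup-≗⇒≡ {u = u} {v} eq = trans (sym (tabulate∘lookup u)) (trans (tabulate-cong eq) (tabulate∘lookup v))

module _ {m} (i j : Fin m) where

  transpose-matchʳ : PC.transpose i j j ≡ i
  transpose-matchʳ with j Finₚ.≟ i
  ... | yes j≡i = j≡i
  ... | no  _ with j Finₚ.≟ j
  ...   | yes _   = refl
  ...   | no  j≢j = ⊥-elim (j≢j refl)

  transpose-other : ∀ {k} → k ≢ i → k ≢ j → PC.transpose i j k ≡ k
  transpose-other {k} k≢i k≢j with k Finₚ.≟ i
  ... | yes k≡i = ⊥-elim (k≢i k≡i)
  ... | no  _ with k Finₚ.≟ j
  ...   | yes k≡j = ⊥-elim (k≢j k≡j)
  ...   | no  _   = refl

  transpose-invariant : (h : Fin m → B) → h i ≡ h j → ∀ k → h (PC.transpose i j k) ≡ h k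
  transpose-invariant h hi≡hj k with k Finₚ.≟ i
  ... | yes refl = sym hi≡hj
  ... | no  _ with k Finₚ.≟ j
  ...   | yes refl = hi≡hj
  ...   | no  _    = refl

iter-+ : (f : A → A) (a b : ℕ) (x : A) → iter f (a + b) x ≡ iter f a (iter f b x)
iter-+ f zero    b x = refl
iter-+ f (suc a) b x = cong f (iter-+ f a b x)

iter-suc : (f : A → A) (t : ℕ) (x : A) → iter f (suc t) x ≡ iter f t (f x)
iter-suc f zero    x = refl
iter-suc f (suc t) x = cong f (iter-suc f t x)

leastIndex : ∀ {m k} → (Fin (suc k) → Fin m) → Fin (suc k)
leastIndex {m} f = Extrema.argmin (Finₚ.≤-totalOrder m) f Fin.zero (allFin _)

leastIndex-≤ : ∀ {m k} (f : Fin (suc k) → Fin m) j → f (leastIndex f) Fin.≤ f j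
leastIndex-≤ {m} f j =
  All.lookup (Extrema.f[argmin]≤f[xs] (Finₚ.≤-totalOrder m) {f = f} Fin.zero (allFin _)) (∈-allFin j)

module _ {m} (φ : Fin m → Fin m) where

  record IsOrbit {k} (f : Fin (suc k) → Fin m) : Set where
    field
      closed     : ∀ i → ∃ λ j → φ (f i) ≡ f j
      transitive : ∀ i j → ∃ λ t → iter φ t (f i) ≡ f j

  open IsOrbit

  iter-closed : ∀ {k} {f : Fin (suc k) → Fin m} → IsOrbit f → ∀ t i → ∃ λ j → iter φ t (f i) ≡ f j
  iter-closed orbit zero    i = i , refl
  iter-closed orbit (suc t) i =
    let j , eq = iter-closed orbit t i ; j′ , eq′ = closed orbit j in j′ , trans (cong φ eq) eq′

  orbit-⊆ : ∀ {k k′} {f : Fin (suc k) → Fin m} {g : Fin (suc k′) → Fin m} → IsOrbit f → IsOrbit g →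
    ∀ {i i′} → f i ≡ g i′ → ∀ j → ∃ λ j′ → f j ≡ g j′
  orbit-⊆ f-orbit g-orbit {i} {i′} fi≡gi′ j =
    let t , eq = transitive f-orbit i j ; j′ , eq′ = iter-closed g-orbit t i′ in
    j′ , trans (sym eq) (trans (cong (iter φ t) fi≡gi′) eq′)

  leastIndex-orbitMin : ∀ {k} {f : Fin (suc k) → Fin m} → IsOrbit f →
    ∀ t → f (leastIndex f) Fin.≤ iter φ t (f (leastIndex f))
  leastIndex-orbitMin {f = f} orbit t =
    let j , eq = iter-closed orbit t (leastIndex f) in subst (f (leastIndex f) Fin.≤_) (sym eq) (leastIndex-≤ f j)

module _ {K : ℕ} where

  next : Fin (suc K) → Fin (suc K)
  next i = fromℕ< (m%n<n (suc (toℕ i)) (suc K))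

  toℕ-next : ∀ i → toℕ (next i) ≡ suc (toℕ i) % suc K
  toℕ-next i = Finₚ.toℕ-fromℕ< (m%n<n (suc (toℕ i)) (suc K))

  toℕ-next-< : ∀ {i} → toℕ i < K → toℕ (next i) ≡ suc (toℕ i)
  toℕ-next-< {i} i<K = trans (toℕ-next i) (m<n⇒m%n≡m (s≤s i<K))

  toℕ-next-last : ∀ {i} → toℕ i ≡ K → toℕ (next i) ≡ 0
  toℕ-next-last {i} i≡K = trans (toℕ-next i) (trans (cong (λ x → suc x % suc K) i≡K) (n%n≡0 (suc K)))

  <-or-last : ∀ (i : Fin (suc K)) → toℕ i < K ⊎ toℕ i ≡ K
  <-or-last i = ℕₚ.m≤n⇒m<n∨m≡n (ℕₚ.≤-pred (Finₚ.toℕ<n i))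

  next-injective : ∀ {i j} → next i ≡ next j → i ≡ j
  next-injective {i} {j} eq with <-or-last i | <-or-last j
  ... | inj₁ i<K | inj₁ j<K =
    Finₚ.toℕ-injective (ℕₚ.suc-injective (trans (sym (toℕ-next-< i<K)) (trans (cong toℕ eq) (toℕ-next-< j<K))))
  ... | inj₁ i<K | inj₂ j≡K
    with () ← trans (sym (toℕ-next-< i<K)) (trans (cong toℕ eq) (toℕ-next-last j≡K))
  ... | inj₂ i≡K | inj₁ j<K
    with () ← trans (sym (toℕ-next-< j<K)) (trans (cong toℕ (sym eq)) (toℕ-next-last i≡K))
  ... | inj₂ i≡K | inj₂ j≡K = Finₚ.toℕ-injective (trans i≡K (sym j≡K))

  toℕ-iter-next : ∀ t i → toℕ i + t ≤ K → toℕ (iter next t i) ≡ toℕ i + t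
  toℕ-iter-next zero    i _   = sym (ℕₚ.+-identityʳ _)
  toℕ-iter-next (suc t) i i+t<K = begin
    toℕ (next (iter next t i)) ≡⟨ toℕ-next-< (ℕₚ.≤-trans (s≤s (≤-reflexive ih)) i+1+t≤K) ⟩
    suc (toℕ (iter next t i))  ≡⟨ cong suc ih ⟩
    suc (toℕ i + t)            ≡⟨ ℕₚ.+-suc (toℕ i) t ⟨
    toℕ i + suc t              ∎
    where
    open ≡-Reasoning
    i+1+t≤K : suc (toℕ i + t) ≤ K
    i+1+t≤K = ≤-trans (≤-reflexive (sym (ℕₚ.+-suc (toℕ i) t))) i+t<K
    ih : toℕ (iter next t i) ≡ toℕ i + t
    ih = toℕ-iter-next t i (ℕₚ.<⇒≤ i+1+t≤K)

  -- climb from i to the last index, wrap around to zero, climb to j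
  iter-next-reaches : ∀ i j → ∃ λ t → iter next t i ≡ j
  iter-next-reaches i j = toℕ j + suc (K ∸ toℕ i) , (begin
    iter next (toℕ j + suc (K ∸ toℕ i)) i             ≡⟨ iter-+ next (toℕ j) (suc (K ∸ toℕ i)) i ⟩
    iter next (toℕ j) (next (iter next (K ∸ toℕ i) i)) ≡⟨ cong (iter next (toℕ j)) wrap ⟩
    iter next (toℕ j) Fin.zero                         ≡⟨ Finₚ.toℕ-injective climb ⟩
    j                                                  ∎)
    where
    open ≡-Reasoning
    i≤K : toℕ i ≤ K
    i≤K = ℕₚ.≤-pred (Finₚ.toℕ<n i)
    climb : toℕ (iter next (toℕ j) Fin.zero) ≡ toℕ j
    climb = toℕ-iter-next (toℕ j) Fin.zero (ℕₚ.≤-pred (Finₚ.toℕ<n j))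
    wrap : next (iter next (K ∸ toℕ i) i) ≡ Fin.zero
    wrap = Finₚ.toℕ-injective (toℕ-next-last
      (trans (toℕ-iter-next (K ∸ toℕ i) i (≤-reflexive (ℕₚ.m+[n∸m]≡n i≤K))) (ℕₚ.m+[n∸m]≡n i≤K)))

  next-surjective : ∀ j → ∃ λ i → next i ≡ j
  next-surjective j with iter-next-reaches (next j) j
  ... | zero  , eq = j , eq
  ... | suc t , eq = iter next t (next j) , eq

data Orientation : Set where
  forward backward : Orientation

module _ (G : Graph) where

  Dart : Set
  Dart = Fin (D G)

  IsRotation-resp-≗ : ∀ {π π′ : Dart → Dart} → π ≗ π′ → IsRotation G π → IsRotation G π′
  IsRotation-resp-≗ {π} {π′} π≗π′ (π-tail , π-injective , π-orbit) =
    (λ x → trans (cong (tail G) (sym (π≗π′ x))) (π-tail x)) ,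
    (λ x y eq → π-injective x y (trans (π≗π′ x) (trans eq (sym (π≗π′ y))))) ,
    (λ x y same → let k , eq = π-orbit x y same in k , trans (sym (iter-resp (toℕ k) x)) eq)
    where
    iter-resp : ∀ k x → iter π k x ≡ iter π′ k x
    iter-resp zero    x = refl
    iter-resp (suc k) x = trans (cong π (iter-resp k x)) (π≗π′ _)

  rotations-complete : ∀ {π} → IsRotation G π → Any (π ≗_) (rotations G)
  rotations-complete {π} rot = Any.map (λ eq x → trans (sym (lookup∘tabulate π x)) (cong-app eq x))
    (∈-filter⁺ (isRotation? G) (∈-map⁺ Vec.lookup (allVecs-complete _ _ (tabulate π)))
      (IsRotation-resp-≗ (λ x → sym (lookup∘tabulate π x)) rot))

  rotations-distinct : AllPairs (λ π π′ → ¬ π ≗ π′) (rotations G)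
  rotations-distinct = AllPairsₚ.filter⁺ (isRotation? G)
    (AllPairsₚ.map⁺ (AllPairs.map (λ u≢v → u≢v ∘ lookup-≗⇒≡) (allVecs-unique (D G) (D G))))

  rotation-moves : ∀ {π a b} → IsRotation G π → tail G a ≡ tail G b → a ≢ b → π a ≢ a
  rotation-moves {π} {a} {b} (_ , _ , π-orbit) same a≢b πa≡a =
    let k , eq = π-orbit a b same in a≢b (trans (sym (iter-fixed (toℕ k))) eq)
    where
    iter-fixed : ∀ k → iter π k a ≡ a
    iter-fixed zero    = refl
    iter-fixed (suc k) = trans (cong π (iter-fixed k)) πa≡a

  conjugate : Permutation′ (D G) → (Dart → Dart) → Dart → Dart
  conjugate ρ π x = ρ ⟨$⟩ʳ π (ρ ⟨$⟩ˡ x)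

  iter-conjugate : ∀ ρ π k x → iter (conjugate ρ π) k x ≡ ρ ⟨$⟩ʳ iter π k (ρ ⟨$⟩ˡ x)
  iter-conjugate ρ π zero    x = sym (inverseʳ ρ)
  iter-conjugate ρ π (suc k) x =
    trans (cong (conjugate ρ π) (iter-conjugate ρ π k x)) (cong (λ y → ρ ⟨$⟩ʳ π y) (inverseˡ ρ))

  conjugate-injective : ∀ ρ {π π′} → conjugate ρ π ≗ conjugate ρ π′ → π ≗ π′
  conjugate-injective ρ {π} {π′} eq x = begin
    π x                             ≡⟨ inverseˡ ρ ⟨
    ρ ⟨$⟩ˡ (ρ ⟨$⟩ʳ π x)              ≡⟨ cong (λ y → ρ ⟨$⟩ˡ (ρ ⟨$⟩ʳ π y)) (inverseˡ ρ) ⟨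
    ρ ⟨$⟩ˡ conjugate ρ π (ρ ⟨$⟩ʳ x)  ≡⟨ cong (ρ ⟨$⟩ˡ_) (eq _) ⟩
    ρ ⟨$⟩ˡ conjugate ρ π′ (ρ ⟨$⟩ʳ x) ≡⟨ cong (λ y → ρ ⟨$⟩ˡ (ρ ⟨$⟩ʳ π′ y)) (inverseˡ ρ) ⟩
    ρ ⟨$⟩ˡ (ρ ⟨$⟩ʳ π′ x)             ≡⟨ inverseˡ ρ ⟩
    π′ x                            ∎
    where open ≡-Reasoning

  IsRotation-conjugate : ∀ ρ {π} → (∀ x → tail G (ρ ⟨$⟩ʳ x) ≡ tail G x) →
    IsRotation G π → IsRotation G (conjugate ρ π)
  IsRotation-conjugate ρ {π} ρ-tail (π-tail , π-injective , π-orbit) =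
    (λ x → trans (ρ-tail _) (trans (π-tail _) (ρˡ-tail x))) ,
    (λ x y eq → trans (sym (inverseʳ ρ)) (trans (cong (ρ ⟨$⟩ʳ_) (π-injective _ _
        (trans (sym (inverseˡ ρ)) (trans (cong (ρ ⟨$⟩ˡ_) eq) (inverseˡ ρ))))) (inverseʳ ρ))) ,
    (λ x y same →
      let k , eq = π-orbit (ρ ⟨$⟩ˡ x) (ρ ⟨$⟩ˡ y) (trans (ρˡ-tail x) (trans same (sym (ρˡ-tail y))))
      in k , trans (iter-conjugate ρ π (toℕ k) x) (trans (cong (ρ ⟨$⟩ʳ_) eq) (inverseʳ ρ)))
    where
    ρˡ-tail : ∀ x → tail G (ρ ⟨$⟩ˡ x) ≡ tail G x
    ρˡ-tail x = trans (sym (ρ-tail _)) (cong (tail G) (inverseʳ ρ))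

  -- Prescribed rotations

  -- (a , b) prescribes that the rotation at the vertex of a takes a to b
  Prescription : Set
  Prescription = Dart × Dart

  Admissible : Prescription → Set
  Admissible (a , b) = tail G a ≡ tail G b × a ≢ b

  AtDistinctVertices : List Prescription → Set
  AtDistinctVertices = AllPairs (λ p q → tail G (proj₁ p) ≢ tail G (proj₁ q))

  Obeys : (Dart → Dart) → List Prescription → Set
  Obeys π = All (λ p → π (proj₁ p) ≡ proj₂ p)

  obeys? : (ps : List Prescription) (π : Dart → Dart) → Dec (Obeys π ps)
  obeys? ps π = All.all? (λ p → π (proj₁ p) Finₚ.≟ proj₂ p) ps

  Obeys-resp-≗ : ∀ {π π′} ps → π ≗ π′ → Obeys π ps → Obeys π′ ps
  Obeys-resp-≗ ps π≗π′ = All.map (λ eq → trans (sym (π≗π′ _)) eq)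

  -- Conjugating by the transposition of b and π a reroutes the rotation at the
  -- vertex of a through a ↦ b and leaves the other vertices alone.
  force : (Dart → Dart) → Prescription → Dart → Dart
  force π (a , b) = conjugate (transpose b (π a)) π

  force-rotation : ∀ {π} p → Admissible p → IsRotation G π → IsRotation G (force π p)
  force-rotation {π} (a , b) (same , _) rot = IsRotation-conjugate (transpose b (π a))
    (transpose-invariant b (π a) (tail G) (trans (sym same) (sym (proj₁ rot a)))) rot

  force-obeys : ∀ {π} p → Admissible p → IsRotation G π → force π p (proj₁ p) ≡ proj₂ p
  force-obeys {π} (a , b) (same , a≢b) rot = begin
    PC.transpose b (π a) (π (PC.transpose (π a) b a))
      ≡⟨ cong (PC.transpose b (π a) ∘ π) (transpose-other (π a) b πa≢a a≢b) ⟩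
    PC.transpose b (π a) (π a)
      ≡⟨ transpose-matchʳ b (π a) ⟩
    b
      ∎
    where
    open ≡-Reasoning
    πa≢a : a ≢ π a
    πa≢a = rotation-moves rot same a≢b ∘ sym

  force-elsewhere : ∀ {π} p x → Admissible p → IsRotation G π →
    tail G x ≢ tail G (proj₁ p) → force π p x ≡ π x
  force-elsewhere {π} (a , b) x (same , _) rot elsewhere =
    trans (cong (PC.transpose b (π a) ∘ π) (transpose-other (π a) b (apart refl (π-tail a)) (apart refl (sym same))))
          (transpose-other b (π a) (apart (π-tail x) (sym same)) (apart (π-tail x) (π-tail a)))
    where
    π-tail : ∀ y → tail G (π y) ≡ tail G y
    π-tail = proj₁ rot
    apart : ∀ {y z} → tail G y ≡ tail G x → tail G z ≡ tail G a → y ≢ z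
    apart ty tz y≡z = elsewhere (trans (sym ty) (trans (cong (tail G) y≡z) tz))

  force-injective : ∀ {π π′} a b → π a ≡ π′ a → force π (a , b) ≗ force π′ (a , b) → π ≗ π′
  force-injective {π} {π′} a b πa≡π′a eq = conjugate-injective (transpose b (π a))
    (λ x → trans (eq x) (cong (λ c → conjugate (transpose b c) π′ x) (sym πa≡π′a)))

  forceAll : (Dart → Dart) → List Prescription → Dart → Dart
  forceAll π []       = π
  forceAll π (p ∷ ps) = forceAll (force π p) ps

  overwritten : (Dart → Dart) → List Prescription → List Dart
  overwritten π []             = []
  overwritten π ((a , b) ∷ ps) = π a ∷ overwritten (force π (a , b)) ps

  forceAll-rotation : ∀ {π} ps → All Admissible ps → IsRotation G π → IsRotation G (forceAll π ps)
  forceAll-rotation []       []           rot = rot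
  forceAll-rotation (p ∷ ps) (adm ∷ adms) rot = forceAll-rotation ps adms (force-rotation p adm rot)

  forceAll-elsewhere : ∀ {π} ps x → All Admissible ps → IsRotation G π →
    All (λ p → tail G x ≢ tail G (proj₁ p)) ps → forceAll π ps x ≡ π x
  forceAll-elsewhere []       x []           rot []                 = refl
  forceAll-elsewhere (p ∷ ps) x (adm ∷ adms) rot (elsewhere ∷ elsewheres) =
    trans (forceAll-elsewhere ps x adms (force-rotation p adm rot) elsewheres) (force-elsewhere p x adm rot elsewhere)

  forceAll-obeys : ∀ {π} ps → All Admissible ps → AtDistinctVertices ps → IsRotation G π → Obeys (forceAll π ps) ps
  forceAll-obeys     []       []           []                      rot = []
  forceAll-obeys {π} (p ∷ ps) (adm ∷ adms) (elsewheres ∷ distinct) rot =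
    trans (forceAll-elsewhere ps (proj₁ p) adms rot′ elsewheres) (force-obeys p adm rot) ∷
    forceAll-obeys ps adms distinct rot′
    where
    rot′ : IsRotation G (force π p)
    rot′ = force-rotation p adm rot

  forceAll-injective : ∀ {π π′} ps → forceAll π ps ≗ forceAll π′ ps →
    overwritten π ps ≡ overwritten π′ ps → π ≗ π′
  forceAll-injective []             eq _  = eq
  forceAll-injective ((a , b) ∷ ps) eq ow =
    force-injective a b (Listₚ.∷-injectiveˡ ow) (forceAll-injective ps eq (Listₚ.∷-injectiveʳ ow))

  otherDarts : Dart → List Dart
  otherDarts a = filter (λ x → ¬? (x Finₚ.≟ a)) (filter (λ x → tail G x Finₚ.≟ tail G a) (allFin (D G)))

  length-otherDarts : ∀ a → length (otherDarts a) < deg G (tail G a)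
  length-otherDarts a = Listₚ.filter-notAll (λ x → ¬? (x Finₚ.≟ a)) _
    (Any.map (λ { refl a≢a → a≢a refl }) (∈-filter⁺ (λ x → tail G x Finₚ.≟ tail G a) (∈-allFin a) refl))

  overwritten-∈ : ∀ {π} ps → All Admissible ps → IsRotation G π →
    Pointwise _∈_ (overwritten π ps) (map (otherDarts ∘ proj₁) ps)
  overwritten-∈     []             []                    rot = []
  overwritten-∈ {π} ((a , b) ∷ ps) ((same , a≢b) ∷ adms) rot =
    ∈-filter⁺ _ (∈-filter⁺ _ (∈-allFin (π a)) (proj₁ rot a)) (rotation-moves rot same a≢b) ∷
    overwritten-∈ ps adms (force-rotation (a , b) (same , a≢b) rot)

  obeying : List Prescription → List (Dart → Dart)
  obeying ps = filter (obeys? ps) (rotations G)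

  obeying-complete : ∀ {π} ps → IsRotation G π → Obeys π ps → Any (π ≗_) (obeying ps)
  obeying-complete {π} ps rot obeys =
    [ Any.map proj₁ , (λ ¬obeys → ⊥-elim (¬obeys (proj₂ (Anyₚ.lookup-result found)))) ]′
      (Anyₚ.filter⁺ (obeys? ps) found)
    where
    found : Any (λ σ → π ≗ σ × Obeys σ ps) (rotations G)
    found = Any.map (λ π≗σ → π≗σ , Obeys-resp-≗ ps π≗σ obeys) (rotations-complete rot)

  -- π ↦ (forceAll π ps , overwritten π ps) is injective.
  numRotations≤obeying*choices : ∀ ps → All Admissible ps → AtDistinctVertices ps →
    numRotations G ≤ length (obeying ps) * length (choices (map (otherDarts ∘ proj₁) ps))
  numRotations≤obeying*choices ps adms distinct = begin
    numRotations G
      ≤⟨ length≤-byInjectiveRelation (λ π π′ → ¬ π ≗ π′) Encodes rotations-distinct encoded injective ⟩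
    length (cartesianProduct (obeying ps) cs)
      ≡⟨ length-cartesianProductWith _,_ (obeying ps) cs ⟩
    length (obeying ps) * length cs
      ∎
    where
    open ℕₚ.≤-Reasoning
    cs : List (List Dart)
    cs = choices (map (otherDarts ∘ proj₁) ps)

    Encodes : (Dart → Dart) → (Dart → Dart) × List Dart → Set
    Encodes π (σ , os) = forceAll π ps ≗ σ × overwritten π ps ≡ os

    encoded : All (λ π → Any (Encodes π) (cartesianProduct (obeying ps) cs)) (rotations G)
    encoded = All.tabulate λ π∈ →
      let rot = proj₂ (∈-filter⁻ (isRotation? G) {xs = map Vec.lookup (allVecs (D G) (D G))} π∈) in
      Any-cartesianProduct⁺
        (Any.map (_, refl) (obeying-complete ps (forceAll-rotation ps adms rot) (forceAll-obeys ps adms distinct rot)))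
        (∈-choices (overwritten-∈ ps adms rot))

    injective : ∀ {π π′ e} → Encodes π e → Encodes π′ e → ¬ ¬ π ≗ π′
    injective (≗σ , ≡os) (≗σ′ , ≡os′) π≉π′ =
      π≉π′ (forceAll-injective ps (λ x → trans (≗σ x) (sym (≗σ′ x))) (trans ≡os (sym ≡os′)))

  numRotations≤obeying*degree^ : ∀ d ps → All Admissible ps → AtDistinctVertices ps →
    All (λ p → deg G (tail G (proj₁ p)) ≤ d) ps →
    numRotations G ≤ length (obeying ps) * (d ∸ 1) ^ length ps
  numRotations≤obeying*degree^ d ps adms distinct degrees = begin
    numRotations G
      ≤⟨ numRotations≤obeying*choices ps adms distinct ⟩
    length (obeying ps) * length (choices (map (otherDarts ∘ proj₁) ps))
      ≤⟨ ℕₚ.*-monoʳ-≤ (length (obeying ps)) (length-choices-≤ _ bounds) ⟩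
    length (obeying ps) * (d ∸ 1) ^ length (map (otherDarts ∘ proj₁) ps)
      ≡⟨ cong (λ l → length (obeying ps) * (d ∸ 1) ^ l) (length-map _ ps) ⟩
    length (obeying ps) * (d ∸ 1) ^ length ps
      ∎
    where
    open ℕₚ.≤-Reasoning
    bounds : All (λ xs → length xs ≤ d ∸ 1) (map (otherDarts ∘ proj₁) ps)
    bounds = Allₚ.map⁺ (All.map (λ {p} deg≤d →
      ℕₚ.∸-monoˡ-≤ 1 (≤-trans (length-otherDarts (proj₁ p)) deg≤d)) degrees)

  -- Cycles and faces

  head≡tail-next : (c : Cycle G) (i : Fin (cycLength c)) → head G (dart c i) ≡ tail G (dart c (next i))
  head≡tail-next c i = closed c i (next i) (toℕ-next i)

  -- the darts of the two faces that would run along c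
  boundary : (c : Cycle G) → Orientation → Fin (cycLength c) → Dart
  boundary c forward  i = σ G (dart c i)
  boundary c backward i = dart c i

  prescription : (c : Cycle G) → Orientation → Fin (cycLength c) → Prescription
  prescription c forward  i = σ G (dart c i) , dart c (next i)
  prescription c backward i = dart c (next i) , σ G (dart c i)

  prescriptions : Cycle G → Orientation → List Prescription
  prescriptions c o = map (prescription c o) (allFin (cycLength c))

  prescription-vertex : ∀ c o i → tail G (proj₁ (prescription c o i)) ≡ tail G (dart c (next i))
  prescription-vertex c forward  i = head≡tail-next c i
  prescription-vertex c backward i = refl

  prescription-admissible : ∀ c o i → Admissible (prescription c o i)
  prescription-admissible c forward  i = head≡tail-next c i , edge-dst c i (next i) ∘ sym
  prescription-admissible c backward i = sym (head≡tail-next c i) , edge-dst c i (next i)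

  prescriptions-admissible : ∀ c o → All Admissible (prescriptions c o)
  prescriptions-admissible c o = Allₚ.map⁺ (All.tabulate λ {i} _ → prescription-admissible c o i)

  prescriptions-atDistinctVertices : ∀ c o → AtDistinctVertices (prescriptions c o)
  prescriptions-atDistinctVertices c o = AllPairsₚ.map⁺ (AllPairs.map
    (λ {i} {j} i≢j same → i≢j (next-injective (vert-inj c _ _
      (trans (sym (prescription-vertex c o i)) (trans same (prescription-vertex c o j))))))
    (allFin⁺ (cycLength c)))

  length-prescriptions : ∀ c o → length (prescriptions c o) ≡ cycLength c
  length-prescriptions c o =
    trans (length-map (prescription c o) (allFin _)) (Listₚ.length-tabulate {n = cycLength c} (λ i → i))

  prescriptions-degrees : ∀ {d} c o → (∀ i → deg G (tail G (dart c i)) ≤ d) →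
    All (λ p → deg G (tail G (proj₁ p)) ≤ d) (prescriptions c o)
  prescriptions-degrees {d} c o degrees = Allₚ.map⁺ (All.tabulate λ {i} _ →
    subst (λ v → deg G v ≤ d) (sym (prescription-vertex c o i)) (degrees (next i)))

  numRotations≤obeying*degree^length : ∀ {d ℓ} c o →
    cycLength c ≤ ℓ → (∀ i → deg G (tail G (dart c i)) ≤ d) →
    numRotations G ≤ length (obeying (prescriptions c o)) * (d ∸ 1) ^ ℓ
  numRotations≤obeying*degree^length {d} {ℓ} c o length≤ℓ degrees = begin
    numRotations G
      ≤⟨ numRotations≤obeying*degree^ d (prescriptions c o) (prescriptions-admissible c o)
           (prescriptions-atDistinctVertices c o) (prescriptions-degrees c o degrees) ⟩
    length (obeying (prescriptions c o)) * (d ∸ 1) ^ length (prescriptions c o)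
      ≡⟨ cong (λ l → length (obeying (prescriptions c o)) * (d ∸ 1) ^ l) (length-prescriptions c o) ⟩
    length (obeying (prescriptions c o)) * (d ∸ 1) ^ cycLength c
      ≤⟨ ℕₚ.*-monoʳ-≤ (length (obeying (prescriptions c o))) (^-monoʳ-≤-suc (d ∸ 1) length≤ℓ) ⟩
    length (obeying (prescriptions c o)) * (d ∸ 1) ^ ℓ
      ∎
    where open ℕₚ.≤-Reasoning

  boundary-isOrbit : ∀ {π} c o → Obeys π (prescriptions c o) → IsOrbit (faceperm G π) (boundary c o)
  boundary-isOrbit {π} c forward obeys = record
    { closed     = λ i → next i , step i
    ; transitive = λ i j → let t , eq = iter-next-reaches i j in t , trans (iter-step t i) (cong (boundary c forward) eq)
    }
    where
    step : ∀ i → faceperm G π (σ G (dart c i)) ≡ σ G (dart c (next i))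
    step i = cong (σ G) (All.lookup (Allₚ.map⁻ obeys) (∈-allFin i))
    iter-step : ∀ t i → iter (faceperm G π) t (σ G (dart c i)) ≡ σ G (dart c (iter next t i))
    iter-step zero    i = refl
    iter-step (suc t) i = trans (cong (faceperm G π) (iter-step t i)) (step _)
  boundary-isOrbit {π} c backward obeys = record
    { closed     = λ i → let i′ , eq = next-surjective i in
        i′ , subst (λ j → faceperm G π (dart c j) ≡ dart c i′) eq (step i′)
    ; transitive = λ i j → let t , eq = iter-next-reaches j i in
        t , trans (cong (iter (faceperm G π) t ∘ dart c) (sym eq)) (iter-step t j)
    }
    where
    step : ∀ i → faceperm G π (dart c (next i)) ≡ dart c i
    step i = trans (cong (σ G) (All.lookup (Allₚ.map⁻ obeys) (∈-allFin i))) (σ-invol G _)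
    iter-step : ∀ t i → iter (faceperm G π) t (dart c (iter next t i)) ≡ dart c i
    iter-step zero    i = refl
    iter-step (suc t) i = begin
      faceperm G π (iter (faceperm G π) t (dart c (next (iter next t i))))
        ≡⟨ cong (λ j → faceperm G π (iter (faceperm G π) t (dart c j))) (iter-suc next t i) ⟩
      faceperm G π (iter (faceperm G π) t (dart c (iter next t (next i))))
        ≡⟨ cong (faceperm G π) (iter-step t (next i)) ⟩
      faceperm G π (dart c (next i))
        ≡⟨ step i ⟩
      dart c i
        ∎
      where open ≡-Reasoning

  OnBoundary : (c : Cycle G) → Orientation → Dart → Set
  OnBoundary c o x = ∃ λ i → (boundary c o i ≡ x) ⊎ (σ G (boundary c o i) ≡ x)

  InCycle⇒OnBoundary : ∀ c o {x} → InCycle c x → OnBoundary c o x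
  InCycle⇒OnBoundary c forward  (i , inj₁ eq) = i , inj₂ (trans (σ-invol G _) eq)
  InCycle⇒OnBoundary c forward  (i , inj₂ eq) = i , inj₁ eq
  InCycle⇒OnBoundary c backward x∈c           = x∈c

  OnBoundary⇒InCycle : ∀ c o {x} → OnBoundary c o x → InCycle c x
  OnBoundary⇒InCycle c forward  (i , inj₁ eq) = i , inj₂ eq
  OnBoundary⇒InCycle c forward  (i , inj₂ eq) = i , inj₁ (trans (sym (σ-invol G _)) eq)
  OnBoundary⇒InCycle c backward x∈c           = x∈c

  boundary-⊆⇒InCycle-⊆ : ∀ c o c′ o′ → (∀ j → ∃ λ j′ → boundary c o j ≡ boundary c′ o′ j′) →
    ∀ x → InCycle c x → InCycle c′ x
  boundary-⊆⇒InCycle-⊆ c o c′ o′ ⊆ x x∈c =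
    let i , on = InCycle⇒OnBoundary c o x∈c ; j′ , eq = ⊆ i in
    OnBoundary⇒InCycle c′ o′ (j′ , subst (λ y → (y ≡ x) ⊎ (σ G y ≡ x)) eq on)

  Apart : Cycle G × Orientation → Cycle G × Orientation → Set
  Apart (c , o) (c′ , o′) = DistinctCycles c c′ ⊎ (c ≡ c′ × o ≢ o′)

  -- Independent of π; it is the least dart of a face whenever π obeys prescriptions c o.
  faceDart : Cycle G × Orientation → Dart
  faceDart (c , o) = boundary c o (leastIndex (boundary c o))

  -- Different oriented cycles whose prescriptions π obeys run along different
  -- faces: equal least darts put the two boundaries into one face orbit, so they
  -- cover the same edges (different cycles are excluded) and a dart together with
  -- its reverse cannot lie on both orientations of one cycle.
  numObeyed≤numFaces : ∀ π (es : List (Cycle G × Orientation)) → AllPairs Apart es →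
    length (filter (λ e → obeys? (uncurry prescriptions e) π) es) ≤ numFaces G π
  numObeyed≤numFaces π es apart = length≤-byInjectiveRelation Apart Marks
    (AllPairsₚ.filter⁺ (λ e → obeys? (uncurry prescriptions e) π) apart) marked injective
    where
    isOrbitMin? : Decidable (IsOrbitMin G π)
    isOrbitMin? = λ x → Finₚ.all? (λ k → x Finₚ.≤? iter (faceperm G π) (toℕ k) x)

    Marks : Cycle G × Orientation → Dart → Set
    Marks e x = Obeys π (uncurry prescriptions e) × x ≡ faceDart e

    marked : All (λ e → Any (Marks e) (filter isOrbitMin? (allFin (D G))))
                 (filter (λ e → obeys? (uncurry prescriptions e) π) es)
    marked = All.tabulate λ { {c , o} e∈ →
      let obeys = proj₂ (∈-filter⁻ (λ e → obeys? (uncurry prescriptions e) π) {xs = es} e∈) in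
      Any.map (λ eq → obeys , sym eq)
        (∈-filter⁺ isOrbitMin? (∈-allFin (faceDart (c , o)))
          (λ k → leastIndex-orbitMin (faceperm G π) (boundary-isOrbit c o obeys) (toℕ k))) }

    injective : ∀ {e e′ x} → Marks e x → Marks e′ x → ¬ Apart e e′
    injective {c , o} {c′ , o′} (obeys , eq) (obeys′ , eq′) (inj₁ c≉c′) =
      c≉c′ λ x → mk⇔ (boundary-⊆⇒InCycle-⊆ c o c′ o′ (orbit-⊆ _ orbit orbit′ same) x)
                     (boundary-⊆⇒InCycle-⊆ c′ o′ c o (orbit-⊆ _ orbit′ orbit (sym same)) x)
      where
      orbit : IsOrbit (faceperm G π) (boundary c o)
      orbit = boundary-isOrbit c o obeys
      orbit′ : IsOrbit (faceperm G π) (boundary c′ o′)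
      orbit′ = boundary-isOrbit c′ o′ obeys′
      same : faceDart (c , o) ≡ faceDart (c′ , o′)
      same = trans (sym eq) eq′
    injective {c , forward}  {.c , forward}  _        _         (inj₂ (refl , o≢o′)) = o≢o′ refl
    injective {c , backward} {.c , backward} _        _         (inj₂ (refl , o≢o′)) = o≢o′ refl
    injective {c , forward}  {.c , backward} (_ , eq) (_ , eq′) (inj₂ (refl , _))    =
      edge-dst c _ _ (sym (trans (sym eq) eq′))
    injective {c , backward} {.c , forward}  (_ , eq) (_ , eq′) (inj₂ (refl , _))    =
      edge-dst c _ _ (trans (sym eq) eq′)

  orientations : List (Cycle G) → List (Cycle G × Orientation)
  orientations = concatMap λ c → (c , forward) ∷ (c , backward) ∷ []

  length-orientations : ∀ C → length (orientations C) ≡ 2 * length C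
  length-orientations []      = refl
  length-orientations (c ∷ C) = trans (cong (suc ∘ suc) (length-orientations C)) (sym (ℕₚ.*-suc 2 (length C)))

  orientations-apart : ∀ {C} → AllPairs DistinctCycles C → AllPairs Apart (orientations C)
  orientations-apart distinct = AllPairsₚ.concat⁺
    (Allₚ.map⁺ (All.tabulate λ _ → (inj₂ (refl , λ ()) ∷ []) ∷ [] ∷ []))
    (AllPairsₚ.map⁺ (AllPairs.map (λ c≉c′ →
      (inj₁ c≉c′ ∷ inj₁ c≉c′ ∷ []) ∷ (inj₁ c≉c′ ∷ inj₁ c≉c′ ∷ []) ∷ []) distinct))

  numRotations≤obeying*degree^length-orientations : ∀ {d ℓ} C →
    All (λ c → cycLength c ≤ ℓ) C → All (λ c → ∀ i → deg G (tail G (dart c i)) ≤ d) C →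
    All (λ e → numRotations G ≤ length (obeying (uncurry prescriptions e)) * (d ∸ 1) ^ ℓ) (orientations C)
  numRotations≤obeying*degree^length-orientations C lengths degrees =
    Allₚ.concat⁺ (Allₚ.map⁺ (All.zipWith (λ {c} (length≤ℓ , degrees) →
      numRotations≤obeying*degree^length c forward  length≤ℓ degrees ∷
      numRotations≤obeying*degree^length c backward length≤ℓ degrees ∷ []) (lengths , degrees)))

  sum-obeying≤totalFaces : ∀ es → AllPairs Apart es →
    sum (map (length ∘ obeying ∘ uncurry prescriptions) es) ≤ totalFaces G
  sum-obeying≤totalFaces es apart = begin
    sum (map (λ e → length (filter (obeys? (uncurry prescriptions e)) (rotations G))) es)
      ≡⟨ double-counting (λ e π → obeys? (uncurry prescriptions e) π) es (rotations G) ⟩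
    sum (map (λ π → length (filter (λ e → obeys? (uncurry prescriptions e) π) es)) (rotations G))
      ≤⟨ sum-map-mono _ (numFaces G) (rotations G) (λ π → numObeyed≤numFaces π es apart) ⟩
    totalFaces G
      ∎
    where open ℕₚ.≤-Reasoning

proposition10 : (G : Graph) (ℓ d : ℕ) (C : List (Cycle G)) →
    AllPairs DistinctCycles C →
    All (λ c → cycLength c ≤ ℓ) C →
    All (λ c → ∀ (i : Fin (cycLength c)) → deg G (tail G (dart c i)) ≤ d) C →
    d ≢ 2 →
    2 * length C * numRotations G ≤ totalFaces G * (d ∸ 1) ^ ℓ
proposition10 G ℓ d C distinct lengths degrees _ = begin
    2 * length C * numRotations G
      ≡⟨ cong (_* numRotations G) (length-orientations G C) ⟨
    length (orientations G C) * numRotations G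
      ≤⟨ length*≤sum-map* _ (orientations G C) (numRotations≤obeying*degree^length-orientations G C lengths degrees) ⟩
    sum (map (length ∘ obeying G ∘ uncurry (prescriptions G)) (orientations G C)) * (d ∸ 1) ^ ℓ
      ≤⟨ ℕₚ.*-monoˡ-≤ ((d ∸ 1) ^ ℓ) (sum-obeying≤totalFaces G _ (orientations-apart G distinct)) ⟩
    totalFaces G * (d ∸ 1) ^ ℓ
      ∎
  where open ℕₚ.≤-Reasoning
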